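{- For any graph $G$ and integer $t\ge3$, $\mathsf{mmbs}_t(G) \leq \mathsf{td}(G)^{\mathsf{td}(G)} \cdot 2^{\mathsf{td}(G)^2}$.
   Context: $\mathsf{td}$ denotes treedepth. A $t$-clique is a set of $t$ pairwise adjacent vertices; $\mathrm{opt}(G)$ is the minimum size of a set intersecting all $t$-cliques of $G$. An instance of Extended $K_t$-Hitting is a pair $(G,\mathcal F)$ with $\mathcal F$ a set of subsets $Z\subseteq V(G)$, $1\le|Z|\le t-1$, $G[Z]$ a clique; $\mathrm{opt}(G,\mathcal F)$ is the minimum size of a set intersecting all $t$-cliques of $G$ and all $Z\in\mathcal F$. $(G,\mathcal F)$ is clean if $\mathrm{opt}(G,\mathcal F)=\mathrm{opt}(G)$. A blocking set of $(G,\mathcal F)$ is a set $\mathcal B$ of subsets $B\subseteq V(G)$ with $1\le|B|\le t-1$, $G[B]$ a clique, and $\mathrm{opt}(G,\mathcal F\cup\mathcal B)>\mathrm{opt}(G,\mathcal F)$. $\mathsf{mmbs}_t(G,\mathcal F)$ is the maximum size of an inclusion-wise minimal blocking set of $(G,\mathcal F)$, and $\mathsf{mmbs}_t(G)$ is the maximum of $\mathsf{mmbs}_t(G,\mathcal F)$ over clean instances $(G,\mathcal F)$. -}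

module Defs where

open import Data.Nat using (ℕ; zero; suc; _≤_; _<_; _∸_)
open import Data.Fin using (Fin)
open import Data.Fin.Subset using (Subset; _∈_; ∣_∣)
open import Data.Maybe using (Maybe; just; nothing)
open import Data.List using (List; _++_)
import Data.List.Membership.Propositional as L
open import Data.Product using (Σ; ∃; _×_; _,_)
open import Data.Sum using (_⊎_)
open import Relation.Binary.PropositionalEquality using (_≡_; _≢_)
open import Relation.Nullary using (¬_)

record Graph (n : ℕ) : Set₁ where
  field
    Adj    : Fin n → Fin n → Set
    sym    : ∀ {u v} → Adj u v → Adj v u
    irrefl : ∀ {u} → ¬ Adj u u
open Graph public

-- Treedepth via elimination forests.
-- A rooted forest on Fin n is given by a parent function.

data Depth {n : ℕ} (parent : Fin n → Maybe (Fin n)) : Fin n → ℕ → Set where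
  root : ∀ {v} → parent v ≡ nothing → Depth parent v 1
  step : ∀ {v u d} → parent v ≡ just u → Depth parent u d → Depth parent v (suc d)

data Anc {n : ℕ} (parent : Fin n → Maybe (Fin n)) (u : Fin n) : Fin n → Set where
  here  : Anc parent u u
  there : ∀ {v w} → parent v ≡ just w → Anc parent u w → Anc parent u v

-- G has an elimination forest of height at most h:
-- a rooted forest (every vertex has a finite depth, i.e. no cycles) of
-- height ≤ h in which every edge joins an ancestor-descendant pair.
TdAtMost : ∀ {n} → Graph n → ℕ → Set
TdAtMost {n} G h =
  Σ (Fin n → Maybe (Fin n)) λ parent →
    (∀ v → ∃ λ d → Depth parent v d × d ≤ h) ×
    (∀ u v → Adj G u v → Anc parent u v ⊎ Anc parent v u)

IsTreedepth : ∀ {n} → Graph n → ℕ → Set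
IsTreedepth G d = TdAtMost G d × (∀ h → TdAtMost G h → d ≤ h)

IsClique : ∀ {n} → Graph n → Subset n → Set
IsClique G K = ∀ u v → u ∈ K → v ∈ K → u ≢ v → Adj G u v

IsTClique : ∀ {n} → Graph n → ℕ → Subset n → Set
IsTClique G t K = ∣ K ∣ ≡ t × IsClique G K

Meets : ∀ {n} → Subset n → Subset n → Set
Meets X Z = ∃ λ v → v ∈ X × v ∈ Z

Family : ℕ → Set
Family n = List (Subset n)

Hitting : ∀ {n} → Graph n → ℕ → Family n → Subset n → Set
Hitting G t F X =
  (∀ K → IsTClique G t K → Meets X K) × (∀ Z → Z L.∈ F → Meets X Z)

IsOpt : ∀ {n} → Graph n → ℕ → Family n → ℕ → Set
IsOpt G t F k =
  (∃ λ X → Hitting G t F X × ∣ X ∣ ≡ k) ×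
  (∀ X → Hitting G t F X → k ≤ ∣ X ∣)

Admissible : ∀ {n} → Graph n → ℕ → Subset n → Set
Admissible G t Z = 1 ≤ ∣ Z ∣ × ∣ Z ∣ ≤ t ∸ 1 × IsClique G Z

IsInstance : ∀ {n} → Graph n → ℕ → Family n → Set
IsInstance G t F = ∀ Z → Z L.∈ F → Admissible G t Z

Clean : ∀ {n} → Graph n → ℕ → Family n → Set
Clean G t F = ∀ a b → IsOpt G t F a → IsOpt G t Data.List.[] b → a ≡ b

Blocking : ∀ {n} → Graph n → ℕ → Family n → Family n → Set
Blocking G t F B =
  (∀ Z → Z L.∈ B → Admissible G t Z) ×
  (∀ a b → IsOpt G t F a → IsOpt G t (F ++ B) b → a < b)

MinimalBlocking : ∀ {n} → Graph n → ℕ → Family n → Family n → Set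
MinimalBlocking G t F B =
  Blocking G t F B ×
  (∀ B' → (∀ Z → Z L.∈ B' → Z L.∈ B) → (∃ λ Z → Z L.∈ B × ¬ (Z L.∈ B')) →
     ¬ Blocking G t F B')

module Submission where

-- Fix an elimination forest of height d and let k = opt(G, F). For each Z in a minimal blocking
-- set B, the family B ∖ {Z} is not blocking, so some hitting set X_Z of F ∪ B ∖ {Z} has size at
-- most k. As Z is a clique, its ancestors form a chain with at most one vertex per depth; the
-- trace of Z is the set of depths at which X_Z contains one of them. If Zi ≠ Zj had equal
-- traces, X_Zi and X_Zj would agree on the common ancestors of Zi and Zj. Let M be the set of
-- vertices below an ancestor of Zi that is not an ancestor of Zj: every edge leaving M ends in
-- such a common ancestor. Taking X_Zi inside M and X_Zj outside gives a hitting set of F, and the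
-- swapped combination a hitting set of F ∪ B; their sizes add up to |X_Zi| + |X_Zj| ≤ 2k, while
-- they are at least k and more than k respectively. Hence traces are distinct and |B| ≤ 2^d.

open import Defs hiding (sym)
open import Data.Bool using (Bool; if_then_else_; true; false)
import Data.Bool as Bool
open import Data.Empty using (⊥; ⊥-elim)
open import Data.Fin using (Fin; zero; suc; toℕ; fromℕ<; combine)
open import Data.Fin.Properties using (2↔Bool; combine-injective; injective⇒≤; toℕ-fromℕ<)
  renaming (_≟_ to _≟ᶠ_)
open import Data.Fin.Subset using (Subset; _∈_; _∉_; ∣_∣; ⊤; Nonempty)
open import Data.Fin.Subset.Properties using (_∈?_; ∈⊤; nonempty?; Empty-unique; ∣⊥∣≡0; drop-there)
open import Data.List using (List; []; _∷_; _++_; length; lookup; filter)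
open import Data.List.Membership.Propositional using () renaming (_∈_ to _∈ˡ_)
open import Data.List.Membership.Propositional.Properties
  using (∈-++⁺ˡ; ∈-++⁺ʳ; ∈-++⁻; ∈-lookup; ∈-filter⁺; ∈-filter⁻)
import Data.List.Relation.Unary.All as All
open import Data.List.Relation.Unary.AllPairs.Core using (_∷_)
open import Data.List.Relation.Unary.Unique.Propositional using (Unique)
open import Data.Maybe using (Maybe; just)
open import Data.Nat using (ℕ; zero; suc; _≤_; _<_; _+_; _*_; _^_; _≤?_; z≤n; s≤s)
open import Data.Nat.Induction using (<-rec)
open import Data.Nat.Properties
  using ( ≤-refl; ≤-trans; <-irrefl; ≮⇒≥; +-mono-≤; +-mono-≤-<; +-suc; +-comm
        ; ≤-reflexive; ≤-antisym; m<n⇒m<1+n; m≤m*n; m≤n*m; m^n≢0; ^-monoʳ-≤; module ≤-Reasoning)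
open import Data.Product using (∃; _×_; _,_; proj₁; proj₂)
open import Data.Sum using (_⊎_; inj₁; inj₂; [_,_]′)
open import Data.Vec using (_∷_; []; here; there)
open import Data.Vec.Properties using (≡-dec)
open import Effect.Monad using (RawMonad)
open import Function using (_∘_; _$_; const; id)
open import Function.Bundles using (_⇔_; mk⇔; Equivalence; Injection; _↣_)
open import Function.Properties.Inverse using (↔⇒↣; ↔-sym)
open import Relation.Binary.Definitions using (DecidableEquality)
open import Relation.Binary.PropositionalEquality
  using (_≡_; _≢_; refl; sym; trans; cong; cong₂; subst; subst₂)
open import Relation.Nullary using (¬_; Dec; does; yes; no; ¬?; contradiction)
open import Relation.Nullary.Decidable using (decidable-stable; ¬¬-excluded-middle)
open import Relation.Nullary.Negation using (¬¬-Monad; ¬¬-map)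
open import Relation.Unary using (Decidable)

-- Adjacency is an arbitrary Set, so optima and subsets cut out by graph predicates exist only
-- under ¬¬; the final inequality is decidable, so decidable-stable discharges the ¬¬ at the end.
open module ¬¬ {a} = RawMonad (¬¬-Monad {a = a}) using (_>>=_; pure)

¬¬-Π-Fin : ∀ {m} {P : Fin m → Set} → (∀ i → ¬ ¬ P i) → ¬ ¬ (∀ i → P i)
¬¬-Π-Fin {zero}  _ = pure λ ()
¬¬-Π-Fin {suc m} f = do
  p₀ ← f zero
  ps ← ¬¬-Π-Fin (f ∘ suc)
  pure λ { zero → p₀ ; (suc i) → ps i }

¬¬-least : (P : ℕ → Set) → ∀ m → P m → ¬ ¬ (∃ λ k → P k × ∀ j → P j → k ≤ j)
¬¬-least P = <-rec _ go
  where
  go : ∀ m → (∀ {j} → j < m → P j → ¬ ¬ (∃ λ k → P k × ∀ j → P j → k ≤ j)) →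
       P m → ¬ ¬ (∃ λ k → P k × ∀ j → P j → k ≤ j)
  go m smaller pm = ¬¬-excluded-middle {A = ∃ λ j → j < m × P j} >>= λ where
    (yes (j , j<m , pj)) → smaller j<m pj
    (no ∄j) → pure (m , pm , λ j pj → ≮⇒≥ λ j<m → ∄j (j , j<m , pj))

_≟ₛ_ : ∀ {n} → DecidableEquality (Subset n)
_≟ₛ_ = ≡-dec Bool._≟_

1≤∣p∣⇒Nonempty : ∀ {n} {p : Subset n} → 1 ≤ ∣ p ∣ → Nonempty p
1≤∣p∣⇒Nonempty {n} {p} 1≤∣p∣ = decidable-stable (nonempty? p) λ p-empty →
  contradiction (subst (1 ≤_) (trans (cong ∣_∣ (Empty-unique p-empty)) (∣⊥∣≡0 n)) 1≤∣p∣) λ ()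

zero∈∷⇔ : ∀ {m} {A : Set} (a? : Dec A) (S : Subset m) → zero ∈ does a? ∷ S ⇔ A
zero∈∷⇔ (yes a) S = mk⇔ (const a) (const here)
zero∈∷⇔ (no ¬a) S = mk⇔ (λ ()) (⊥-elim ∘ ¬a)

decidable-subset : ∀ {m} {P : Fin m → Set} → Decidable P → ∃ λ S → ∀ x → x ∈ S ⇔ P x
decidable-subset {zero} P? = [] , λ ()
decidable-subset {suc m} P? with decidable-subset (P? ∘ suc)
... | S , spec = does (P? zero) ∷ S , λ where
  zero    → zero∈∷⇔ (P? zero) S
  (suc x) → mk⇔ (Equivalence.to (spec x) ∘ drop-there) (there ∘ Equivalence.from (spec x))

¬¬-comprehension : ∀ {m} (P : Fin m → Set) → ¬ ¬ (∃ λ S → ∀ x → x ∈ S ⇔ P x)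
¬¬-comprehension P = ¬¬-map decidable-subset (¬¬-Π-Fin λ _ → ¬¬-excluded-middle)

splice : ∀ {n} → Subset n → Subset n → Subset n → Subset n
splice []      []      []      = []
splice (m ∷ M) (a ∷ A) (b ∷ B) = (if m then a else b) ∷ splice M A B

∈-splice⁺ˡ : ∀ {n} {x : Fin n} M A B → x ∈ M → x ∈ A → x ∈ splice M A B
∈-splice⁺ˡ (_ ∷ M) (_ ∷ A) (_ ∷ B) here      here      = here
∈-splice⁺ˡ (_ ∷ M) (_ ∷ A) (_ ∷ B) (there p) (there q) = there (∈-splice⁺ˡ M A B p q)

∈-splice⁺ʳ : ∀ {n} {x : Fin n} M A B → x ∉ M → x ∈ B → x ∈ splice M A B
∈-splice⁺ʳ (true  ∷ M) (_ ∷ A) (_ ∷ B) x∉M here      = ⊥-elim (x∉M here)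
∈-splice⁺ʳ (false ∷ M) (_ ∷ A) (_ ∷ B) x∉M here      = here
∈-splice⁺ʳ (_     ∷ M) (_ ∷ A) (_ ∷ B) x∉M (there q) = there (∈-splice⁺ʳ M A B (x∉M ∘ there) q)

∣∷∣+∣∷∣-cong : ∀ {n} a b (p q p′ q′ : Subset n) → ∣ p ∣ + ∣ q ∣ ≡ ∣ p′ ∣ + ∣ q′ ∣ →
               ∣ a ∷ p ∣ + ∣ b ∷ q ∣ ≡ ∣ a ∷ p′ ∣ + ∣ b ∷ q′ ∣
∣∷∣+∣∷∣-cong false false _ _ _ _ e = e
∣∷∣+∣∷∣-cong true  false _ _ _ _ e = cong suc e
∣∷∣+∣∷∣-cong false true  p q p′ q′ e =
  trans (+-suc ∣ p ∣ ∣ q ∣) (trans (cong suc e) (sym (+-suc ∣ p′ ∣ ∣ q′ ∣)))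
∣∷∣+∣∷∣-cong true  true  p q p′ q′ e = cong suc (∣∷∣+∣∷∣-cong false true p q p′ q′ e)

∣splice∣+∣splice∣ : ∀ {n} (M A B : Subset n) → ∣ splice M A B ∣ + ∣ splice M B A ∣ ≡ ∣ A ∣ + ∣ B ∣
∣splice∣+∣splice∣ []          []      []      = refl
∣splice∣+∣splice∣ (true  ∷ M) (a ∷ A) (b ∷ B) =
  ∣∷∣+∣∷∣-cong a b (splice M A B) (splice M B A) A B (∣splice∣+∣splice∣ M A B)
∣splice∣+∣splice∣ (false ∷ M) (a ∷ A) (b ∷ B) =
  trans (+-comm ∣ b ∷ splice M A B ∣ ∣ a ∷ splice M B A ∣)
        (∣∷∣+∣∷∣-cong a b (splice M B A) (splice M A B) A B
          (trans (+-comm ∣ splice M B A ∣ ∣ splice M A B ∣) (∣splice∣+∣splice∣ M A B)))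

bit↣ : Bool ↣ Fin 2
bit↣ = ↔⇒↣ (↔-sym 2↔Bool)

encode : ∀ {h} → Subset h → Fin (2 ^ h)
encode []      = zero
encode (x ∷ s) = combine (Injection.to bit↣ x) (encode s)

encode-injective : ∀ {h} {s s′ : Subset h} → encode s ≡ encode s′ → s ≡ s′
encode-injective {s = []}    {[]}      _  = refl
encode-injective {s = x ∷ s} {y ∷ s′} eq with combine-injective _ (encode s) _ (encode s′) eq
... | bits≡ , codes≡ = cong₂ _∷_ (Injection.injective bit↣ bits≡) (encode-injective codes≡)

lookup-injective : ∀ {A : Set} {xs : List A} → Unique xs → ∀ i j → lookup xs i ≡ lookup xs j → i ≡ j
lookup-injective (_   ∷ _) zero    zero    _  = refl
lookup-injective (x∉ ∷ _) zero    (suc j) eq = ⊥-elim (All.lookup x∉ (∈-lookup j) eq)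
lookup-injective (x∉ ∷ _) (suc i) zero    eq = ⊥-elim (All.lookup x∉ (∈-lookup i) (sym eq))
lookup-injective (_   ∷ u) (suc i) (suc j) eq = cong suc (lookup-injective u i j eq)

_∖_ : ∀ {n} → Family n → Subset n → Family n
Fs ∖ Z = filter (λ W → ¬? (W ≟ₛ Z)) Fs

∈-∖⁺ : ∀ {n} {Fs : Family n} {Z W} → W ∈ˡ Fs → W ≢ Z → W ∈ˡ Fs ∖ Z
∈-∖⁺ = ∈-filter⁺ (λ W → ¬? (W ≟ₛ _))

∈-∖⁻ : ∀ {n} (Fs : Family n) {Z W} → W ∈ˡ Fs ∖ Z → W ∈ˡ Fs × W ≢ Z
∈-∖⁻ Fs = ∈-filter⁻ (λ W → ¬? (W ≟ₛ _)) {xs = Fs}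

module Forest {n} (parent : Fin n → Maybe (Fin n)) where

  private
    just-injective : ∀ {u v : Fin n} → just u ≡ just v → u ≡ v
    just-injective refl = refl

  Anc-trans : ∀ {u v w} → Anc parent u v → Anc parent v w → Anc parent u w
  Anc-trans u≼v here            = u≼v
  Anc-trans u≼v (there p≡ v≼w) = there p≡ (Anc-trans u≼v v≼w)

  Anc-comparable : ∀ {u v x} → Anc parent u x → Anc parent v x → Anc parent u v ⊎ Anc parent v u
  Anc-comparable here           v≼x             = inj₂ v≼x
  Anc-comparable (there p≡ u≼w) here            = inj₁ (there p≡ u≼w)
  Anc-comparable (there p≡ u≼w) (there p≡′ v≼w′)
    with refl ← just-injective (trans (sym p≡) p≡′) = Anc-comparable u≼w v≼w′

  Depth-functional : ∀ {v a b} → Depth parent v a → Depth parent v b → a ≡ b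
  Depth-functional (root _)    (root _)      = refl
  Depth-functional (root p≡)   (step p≡′ _) with () ← trans (sym p≡) p≡′
  Depth-functional (step p≡ _) (root p≡′)   with () ← trans (sym p≡) p≡′
  Depth-functional (step p≡ D) (step p≡′ D′)
    with refl ← just-injective (trans (sym p≡) p≡′) = cong suc (Depth-functional D D′)

  Anc⇒≡⊎Depth< : ∀ {u v a b} → Anc parent u v → Depth parent u a → Depth parent v b → u ≡ v ⊎ a < b
  Anc⇒≡⊎Depth< here           _  _            = inj₁ refl
  Anc⇒≡⊎Depth< (there p≡ u≼w) _  (root p≡′)  with () ← trans (sym p≡) p≡′
  Anc⇒≡⊎Depth< (there p≡ u≼w) Du (step p≡′ Dw)
    with refl ← just-injective (trans (sym p≡) p≡′) with Anc⇒≡⊎Depth< u≼w Du Dw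
  ... | inj₁ refl = inj₂ (s≤s (≤-reflexive (Depth-functional Du Dw)))
  ... | inj₂ a<b  = inj₂ (m<n⇒m<1+n a<b)

  Anc-same-depth⇒≡ : ∀ {u v x d} → Anc parent u x → Anc parent v x →
                     Depth parent u d → Depth parent v d → u ≡ v
  Anc-same-depth⇒≡ u≼x v≼x Du Dv with Anc-comparable u≼x v≼x
  ... | inj₁ u≼v = [ id , ⊥-elim ∘ <-irrefl refl ]′ (Anc⇒≡⊎Depth< u≼v Du Dv)
  ... | inj₂ v≼u = [ sym , ⊥-elim ∘ <-irrefl refl ]′ (Anc⇒≡⊎Depth< v≼u Dv Du)

module OptimalHitting {n} (G : Graph n) (t : ℕ) where

  IsOpt-unique : ∀ {Fs a b} → IsOpt G t Fs a → IsOpt G t Fs b → a ≡ b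
  IsOpt-unique ((Xa , hit-a , ∣Xa∣≡a) , min-a) ((Xb , hit-b , ∣Xb∣≡b) , min-b) =
    ≤-antisym (subst (_ ≤_) ∣Xb∣≡b (min-a Xb hit-b)) (subst (_ ≤_) ∣Xa∣≡a (min-b Xa hit-a))

  ++-IsInstance : ∀ {F B} → IsInstance G t F → IsInstance G t B → IsInstance G t (F ++ B)
  ++-IsInstance {F} instF instB Z Z∈ = [ instF Z , instB Z ]′ (∈-++⁻ F Z∈)

  ⊤-Hitting : 1 ≤ t → ∀ {Fs} → IsInstance G t Fs → Hitting G t Fs ⊤
  ⊤-Hitting 1≤t inst =
    (λ K (∣K∣≡t , _) → meets (subst (1 ≤_) (sym ∣K∣≡t) 1≤t)) , λ Z Z∈ → meets (proj₁ (inst Z Z∈))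
    where
    meets : ∀ {Z} → 1 ≤ ∣ Z ∣ → Meets ⊤ Z
    meets 1≤∣Z∣ with x , x∈Z ← 1≤∣p∣⇒Nonempty 1≤∣Z∣ = x , ∈⊤ , x∈Z

  ¬¬-IsOpt : 1 ≤ t → ∀ {Fs} → IsInstance G t Fs → ¬ ¬ ∃ (IsOpt G t Fs)
  ¬¬-IsOpt 1≤t {Fs} inst = do
    (k , (X , hit , ∣X∣≡k) , least) ←
      ¬¬-least (λ j → ∃ λ X → Hitting G t Fs X × ∣ X ∣ ≡ j) _ (⊤ , ⊤-Hitting 1≤t inst , refl)
    pure (k , (X , hit , ∣X∣≡k) , λ Y hit′ → least ∣ Y ∣ (Y , hit′ , refl))

  blocking⇒lower-bound : ∀ {F B k b} → IsOpt G t F k → IsOpt G t (F ++ B) b → Blocking G t F B →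
                         ∀ X → Hitting G t (F ++ B) X → k < ∣ X ∣
  blocking⇒lower-bound optF optFB (_ , raises) X hit =
    ≤-trans (raises _ _ optF optFB) (proj₂ optFB X hit)

  non-blocking⇒small-hitting : 1 ≤ t → ∀ {F B k} → IsOpt G t F k → IsInstance G t F →
    IsInstance G t B → ¬ Blocking G t F B → ¬ ¬ ∃ λ X → Hitting G t (F ++ B) X × ∣ X ∣ ≤ k
  non-blocking⇒small-hitting 1≤t optF instF instB ¬blocking = do
    (b , optFB@((X , hit , ∣X∣≡b) , _)) ← ¬¬-IsOpt 1≤t (++-IsInstance instF instB)
    pure (X , hit , ≮⇒≥ λ k<∣X∣ → ¬blocking (instB , λ a c optF′ optFB′ →
      subst₂ _<_ (IsOpt-unique optF optF′) (trans ∣X∣≡b (IsOpt-unique optFB optFB′)) k<∣X∣))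

  minimal⇒small-hitting : 1 ≤ t → ∀ {F B k Z} → IsOpt G t F k → IsInstance G t F →
    MinimalBlocking G t F B → Z ∈ˡ B → ¬ ¬ ∃ λ X → Hitting G t (F ++ (B ∖ Z)) X × ∣ X ∣ ≤ k
  minimal⇒small-hitting 1≤t {B = B} {Z = Z} optF instF ((instB , _) , minimal) Z∈B =
    non-blocking⇒small-hitting 1≤t optF instF (λ W → instB W ∘ proj₁ ∘ ∈-∖⁻ B)
      (minimal (B ∖ Z) (λ W → proj₁ ∘ ∈-∖⁻ B) (Z , Z∈B , λ Z∈B∖Z → proj₂ (∈-∖⁻ B Z∈B∖Z) refl))

-- Exchanging two hitting sets

module _ {n} {G : Graph n} where

  splice-meets-clique : ∀ M P Q {K} →
    (∀ {w z} → w ∈ M → z ∉ M → Adj G w z → z ∈ P → z ∈ Q) →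
    IsClique G K → Meets P K → Meets Q K → Meets (splice M P Q) K
  splice-meets-clique M P Q agree clique (z , z∈P , z∈K) (w , w∈Q , w∈K) with z ∈? M | w ∈? M
  ... | yes z∈M | _       = z , ∈-splice⁺ˡ M P Q z∈M z∈P , z∈K
  ... | no z∉M  | no w∉M  = w , ∈-splice⁺ʳ M P Q w∉M w∈Q , w∈K
  ... | no z∉M  | yes w∈M = z , ∈-splice⁺ʳ M P Q z∉M (agree w∈M z∉M (clique w z w∈K z∈K w≢z) z∈P) , z∈K
    where
    w≢z : w ≢ z
    w≢z refl = z∉M w∈M

module Exchange {n} (G : Graph n) (t h : ℕ) (forest : TdAtMost G h) (F B : Family n) (k : ℕ)
  (F-clique : ∀ Z → Z ∈ˡ F → IsClique G Z)
  (B-clique : ∀ Z → Z ∈ˡ B → IsClique G Z)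
  (F-lower : ∀ X → Hitting G t F X → k ≤ ∣ X ∣)
  (FB-lower : ∀ X → Hitting G t (F ++ B) X → k < ∣ X ∣) where

  parent : Fin n → Maybe (Fin n)
  parent = proj₁ forest

  open Forest parent

  edge-vertical : ∀ u v → Adj G u v → Anc parent u v ⊎ Anc parent v u
  edge-vertical = proj₂ (proj₂ forest)

  depth-index : ∀ y → ∃ λ (i : Fin h) → Depth parent y (suc (toℕ i))
  depth-index y with proj₁ (proj₂ forest) y
  ... | suc d , D , d<h = fromℕ< d<h , subst (Depth parent y ∘ suc) (sym (toℕ-fromℕ< d<h)) D

  Above : Subset n → Fin n → Set
  Above Z y = ∃ λ z → z ∈ Z × Anc parent y z

  Anc-Above : ∀ {Z y u} → Anc parent y u → Above Z u → Above Z y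
  Anc-Above y≼u (z , z∈Z , u≼z) = z , z∈Z , Anc-trans y≼u u≼z

  Above-clique-same-depth⇒≡ : ∀ {Z y y′ d} → IsClique G Z → Above Z y → Above Z y′ →
                              Depth parent y d → Depth parent y′ d → y ≡ y′
  Above-clique-same-depth⇒≡ clique (z , z∈Z , y≼z) (z′ , z′∈Z , y′≼z′) D D′ with z ≟ᶠ z′
  ... | yes refl = Anc-same-depth⇒≡ y≼z y′≼z′ D D′
  ... | no z≢z′ with edge-vertical z z′ (clique z z′ z∈Z z′∈Z z≢z′)
  ...   | inj₁ z≼z′ = Anc-same-depth⇒≡ (Anc-trans y≼z z≼z′) y′≼z′ D D′
  ...   | inj₂ z′≼z = Anc-same-depth⇒≡ y≼z (Anc-trans y′≼z′ z′≼z) D D′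

  record Witness (Z : Subset n) : Set where
    field
      X          : Subset n
      hitting    : Hitting G t (F ++ (B ∖ Z)) X
      small      : ∣ X ∣ ≤ k
      trace      : Subset h
      trace-spec : ∀ i → i ∈ trace ⇔ ∃ λ y → Depth parent y (suc (toℕ i)) × Above Z y × y ∈ X

    hits-cliques : ∀ K → IsTClique G t K → Meets X K
    hits-cliques = proj₁ hitting

    hits-F : ∀ W → W ∈ˡ F → Meets X W
    hits-F W W∈F = proj₂ hitting W (∈-++⁺ˡ W∈F)

    hits-B : ∀ W → W ∈ˡ B → W ≢ Z → Meets X W
    hits-B W W∈B W≢Z = proj₂ hitting W (∈-++⁺ʳ F (∈-∖⁺ W∈B W≢Z))

  open Witness

  ¬¬-witness : ∀ {Z X} → Hitting G t (F ++ (B ∖ Z)) X → ∣ X ∣ ≤ k → ¬ ¬ Witness Z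
  ¬¬-witness {Z} {X} hit small = do
    (trace , spec) ← ¬¬-comprehension λ i → ∃ λ y → Depth parent y (suc (toℕ i)) × Above Z y × y ∈ X
    pure record { X = X ; hitting = hit ; small = small ; trace = trace ; trace-spec = spec }

  trace-transfer : ∀ {Zi Zj} → IsClique G Zj → (Wi : Witness Zi) (Wj : Witness Zj) →
    trace Wi ≡ trace Wj → ∀ {y} → Above Zi y → Above Zj y → y ∈ X Wi → y ∈ X Wj
  trace-transfer clique Wi Wj same {y} ai aj y∈Xi
    with i , D ← depth-index y
    with y′ , D′ , aj′ , y′∈Xj ← Equivalence.to (trace-spec Wj i)
           (subst (i ∈_) same (Equivalence.from (trace-spec Wi i) (y , D , ai , y∈Xi)))
    = subst (_∈ X Wj) (sym (Above-clique-same-depth⇒≡ clique aj aj′ D D′)) y′∈Xj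

  BelowFork : Subset n → Subset n → Fin n → Set
  BelowFork Zi Zj x = ∃ λ u → Anc parent u x × Above Zi u × ¬ Above Zj u

  module EqualTraces {Zi Zj} (Zi∈B : Zi ∈ˡ B) (Zj∈B : Zj ∈ˡ B) (Zi≢Zj : Zi ≢ Zj)
    (Wi : Witness Zi) (Wj : Witness Zj) (same : trace Wi ≡ trace Wj)
    (M : Subset n) (M-spec : ∀ x → x ∈ M ⇔ BelowFork Zi Zj x) where

    Xi Xj Y₁ Y₂ : Subset n
    Xi = X Wi
    Xj = X Wj
    Y₁ = splice M Xi Xj
    Y₂ = splice M Xj Xi

    BelowFork⇒∈M : ∀ {x} → BelowFork Zi Zj x → x ∈ M
    BelowFork⇒∈M = Equivalence.from (M-spec _)

    Above-∉M⇒¬¬Above : ∀ {z} → Above Zi z → z ∉ M → ¬ ¬ Above Zj z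
    Above-∉M⇒¬¬Above ai z∉M ¬aj = z∉M (BelowFork⇒∈M (_ , here , ai , ¬aj))

    boundary-Above : ∀ {w z} → w ∈ M → z ∉ M → Adj G w z → Above Zi z
    boundary-Above {w} {z} w∈M z∉M w~z with Equivalence.to (M-spec w) w∈M
    ... | u , u≼w , ai , ¬aj with edge-vertical w z w~z
    ...   | inj₁ w≼z = ⊥-elim (z∉M (BelowFork⇒∈M (u , Anc-trans u≼w w≼z , ai , ¬aj)))
    ...   | inj₂ z≼w with Anc-comparable u≼w z≼w
    ...     | inj₁ u≼z = ⊥-elim (z∉M (BelowFork⇒∈M (u , u≼z , ai , ¬aj)))
    ...     | inj₂ z≼u = Anc-Above z≼u ai

    Xi⇒Xj : ∀ {z} → Above Zi z → z ∉ M → z ∈ Xi → z ∈ Xj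
    Xi⇒Xj {z} ai z∉M z∈Xi = decidable-stable (z ∈? Xj)
      (¬¬-map (λ aj → trace-transfer (B-clique Zj Zj∈B) Wi Wj same ai aj z∈Xi) (Above-∉M⇒¬¬Above ai z∉M))

    Xj⇒Xi : ∀ {z} → Above Zi z → z ∉ M → z ∈ Xj → z ∈ Xi
    Xj⇒Xi {z} ai z∉M z∈Xj = decidable-stable (z ∈? Xi)
      (¬¬-map (λ aj → trace-transfer (B-clique Zi Zi∈B) Wj Wi (sym same) aj ai z∈Xj) (Above-∉M⇒¬¬Above ai z∉M))

    Y₁-meets : ∀ {K} → IsClique G K → Meets Xi K → Meets Xj K → Meets Y₁ K
    Y₁-meets = splice-meets-clique {G = G} M Xi Xj λ w∈M z∉M w~z → Xi⇒Xj (boundary-Above w∈M z∉M w~z) z∉M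

    Y₂-meets : ∀ {K} → IsClique G K → Meets Xj K → Meets Xi K → Meets Y₂ K
    Y₂-meets = splice-meets-clique {G = G} M Xj Xi λ w∈M z∉M w~z → Xj⇒Xi (boundary-Above w∈M z∉M w~z) z∉M

    Y₂-meets-Zi : Meets Y₂ Zi
    Y₂-meets-Zi with z , z∈Xj , z∈Zi ← hits-B Wj Zi Zi∈B Zi≢Zj with z ∈? M
    ... | yes z∈M = z , ∈-splice⁺ˡ M Xj Xi z∈M z∈Xj , z∈Zi
    ... | no z∉M  = z , ∈-splice⁺ʳ M Xj Xi z∉M (Xj⇒Xi (z , z∈Zi , here) z∉M z∈Xj) , z∈Zi

    Y₂-meets-Zj : Meets Y₂ Zj
    Y₂-meets-Zj with z , z∈Xi , z∈Zj ← hits-B Wi Zj Zj∈B (Zi≢Zj ∘ sym) =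
      z , ∈-splice⁺ʳ M Xj Xi z∉M z∈Xi , z∈Zj
      where
      z∉M : z ∉ M
      z∉M z∈M with _ , u≼z , _ , ¬aj ← Equivalence.to (M-spec z) z∈M = ¬aj (z , z∈Zj , u≼z)

    Y₁-hitting : Hitting G t F Y₁
    Y₁-hitting =
      (λ K K-clique → Y₁-meets (proj₂ K-clique) (hits-cliques Wi K K-clique) (hits-cliques Wj K K-clique)) ,
      (λ Z Z∈F → Y₁-meets (F-clique Z Z∈F) (hits-F Wi Z Z∈F) (hits-F Wj Z Z∈F))

    Y₂-hitting : Hitting G t (F ++ B) Y₂
    Y₂-hitting =
      (λ K K-clique → Y₂-meets (proj₂ K-clique) (hits-cliques Wj K K-clique) (hits-cliques Wi K K-clique)) ,
      meets
      where
      meets : ∀ Z → Z ∈ˡ F ++ B → Meets Y₂ Z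
      meets Z Z∈ with ∈-++⁻ F Z∈
      ... | inj₁ Z∈F = Y₂-meets (F-clique Z Z∈F) (hits-F Wj Z Z∈F) (hits-F Wi Z Z∈F)
      ... | inj₂ Z∈B with Z ≟ₛ Zi | Z ≟ₛ Zj
      ...   | yes refl | _        = Y₂-meets-Zi
      ...   | no _     | yes refl = Y₂-meets-Zj
      ...   | no Z≢Zi  | no Z≢Zj  = Y₂-meets (B-clique Z Z∈B) (hits-B Wj Z Z∈B Z≢Zj) (hits-B Wi Z Z∈B Z≢Zi)

    absurd : ⊥
    absurd = <-irrefl refl $ begin-strict
      k + k            <⟨ +-mono-≤-< (F-lower Y₁ Y₁-hitting) (FB-lower Y₂ Y₂-hitting) ⟩
      ∣ Y₁ ∣ + ∣ Y₂ ∣  ≡⟨ ∣splice∣+∣splice∣ M Xi Xj ⟩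
      ∣ Xi ∣ + ∣ Xj ∣  ≤⟨ +-mono-≤ (small Wi) (small Wj) ⟩
      k + k            ∎
      where open ≤-Reasoning

  distinct-traces : ∀ {Zi Zj} → Zi ∈ˡ B → Zj ∈ˡ B → Zi ≢ Zj →
                    (Wi : Witness Zi) (Wj : Witness Zj) → trace Wi ≢ trace Wj
  distinct-traces {Zi} {Zj} Zi∈B Zj∈B Zi≢Zj Wi Wj same =
    ¬¬-comprehension (BelowFork Zi Zj) λ (M , M-spec) →
      EqualTraces.absurd Zi∈B Zj∈B Zi≢Zj Wi Wj same M M-spec

  length≤2^h : Unique B → (∀ i → Witness (lookup B i)) → length B ≤ 2 ^ h
  length≤2^h unique W = injective⇒≤ code-injective
    where
    code-injective : ∀ {i j} → encode (trace (W i)) ≡ encode (trace (W j)) → i ≡ j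
    code-injective {i} {j} codes≡ with i ≟ᶠ j
    ... | yes i≡j = i≡j
    ... | no i≢j  = ⊥-elim (distinct-traces (∈-lookup i) (∈-lookup j) (i≢j ∘ lookup-injective unique i j)
                                            (W i) (W j) (encode-injective codes≡))

2^d≤d^d*2^[d*d] : ∀ d → 2 ^ d ≤ (d ^ d) * (2 ^ (d * d))
2^d≤d^d*2^[d*d] zero        = ≤-refl
2^d≤d^d*2^[d*d] d@(suc _) = begin
  2 ^ d                  ≤⟨ ^-monoʳ-≤ 2 (m≤m*n d d) ⟩
  2 ^ (d * d)            ≤⟨ m≤n*m (2 ^ (d * d)) (d ^ d) {{m^n≢0 d d}} ⟩
  d ^ d * 2 ^ (d * d)    ∎
  where open ≤-Reasoning

lemma31 : ∀ {n} (G : Graph n) (t : ℕ) → 3 ≤ t → ∀ d → IsTreedepth G d →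
    ∀ (F : Family n) → IsInstance G t F → Clean G t F →
    ∀ (B : Family n) → Unique B → MinimalBlocking G t F B →
    length B ≤ (d ^ d) * (2 ^ (d * d))
lemma31 G t 3≤t d (forest , _) F instF _ B unique minimal@(blocking@(instB , _) , _) =
  ≤-trans (decidable-stable (length B ≤? 2 ^ d) (do
    (k , optF) ← ¬¬-IsOpt 1≤t instF
    (_ , optFB) ← ¬¬-IsOpt 1≤t (++-IsInstance instF instB)
    let open Exchange G t d forest F B k (clique instF) (clique instB) (proj₂ optF)
                      (blocking⇒lower-bound optF optFB blocking)
    W ← ¬¬-Π-Fin λ i → do
      (_ , hit , small) ← minimal⇒small-hitting 1≤t optF instF minimal (∈-lookup i)
      ¬¬-witness hit small
    pure (length≤2^h unique W)))
  (2^d≤d^d*2^[d*d] d)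
  where
  open OptimalHitting G t
  1≤t : 1 ≤ t
  1≤t = ≤-trans (s≤s z≤n) 3≤t
  clique : ∀ {Fs} → IsInstance G t Fs → ∀ Z → Z ∈ˡ Fs → IsClique G Z
  clique inst Z = proj₂ ∘ proj₂ ∘ inst Z
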